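{- For a prime $p$, let $a_k = 2pk + (k^2 \bmod p)$ for $k=1,\ldots,p-1$ and $b_i=a_{i+1}-a_i$ for $i=1,\ldots,p-2$. Let $\mathcal{C}_p$ be the labeled tree ("hair comb") consisting of a path (the spine) whose edges are all labeled $0$ and which is the concatenation of consecutive segments of lengths $b_1,b_2,\ldots,b_{p-2}$, thus having $p-1$ distinguished nodes (the two endpoints of the spine and the $p-3$ junctions between consecutive segments), together with, attached at each of these $p-1$ distinguished nodes, a pendant path of $p$ edges all labeled $1$. Then the number $|\mathrm{Pal}(\mathcal{C}_p)|$ of distinct palindromes in the language of $\mathcal{C}_p$ is in $\Theta(p^3)$ as $p$ ranges over the primes.
   Context: For nodes $x,y$ of a labeled tree, $\pi(x,y)$ is the word of labels along the unique simple path from $x$ to $y$; the language of the tree is the set of all $\pi(x,y)$, and $\mathrm{Pal}$ of the tree is the set of words in its language equal to their reversal (including the empty word). $k^2 \bmod p$ is the least nonnegative residue. -}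

module Defs where

open import Data.Bool using (if_then_else_)
open import Data.Nat using (ℕ; zero; suc; _+_; _*_; _∸_; _≡ᵇ_; ∣_-_∣)
open import Data.Nat.Properties using (_≟_)
open import Data.Nat.DivMod using (_%_)
open import Data.List using (List; []; _∷_; _++_; map; concatMap; replicate; reverse; upTo; filter; deduplicate; length)
open import Data.List.Properties using (≡-dec)
open import Relation.Binary.PropositionalEquality using (_≡_)
open import Relation.Nullary using (Dec)

-- k² mod p, the least nonnegative residue (p is a prime, so p ≥ 2;
-- the p = 0 clause is never used).
sqmod : ℕ → ℕ → ℕ
sqmod zero    k = k * k
sqmod (suc q) k = (k * k) % suc q

a : ℕ → ℕ → ℕ
a p k = 2 * p * k + sqmod p k

-- Spine: nodes 0,1,…,L, where L = b_1 + … + b_{p-2} = a_{p-1} - a_1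
-- (consecutive segments of lengths b_1,…,b_{p-2}); all spine edges labeled 0.
spineLength : ℕ → ℕ
spineLength p = a p (p ∸ 1) ∸ a p 1

-- Position on the spine of the k-th distinguished node (k = 1,…,p-1):
-- b_1 + … + b_{k-1} = a_k - a_1.
pos : ℕ → ℕ → ℕ
pos p k = a p k ∸ a p 1

-- Nodes of the hair comb C_p:
--   spine s   : spine node at position s (0 ≤ s ≤ L)
--   hair k d  : node at distance d (1 ≤ d ≤ p) from the k-th distinguished
--               node, on its pendant path (edges labeled 1), 1 ≤ k ≤ p-1.
data Node : Set where
  spine : ℕ → Node
  hair  : ℕ → ℕ → Node

nodes : ℕ → List Node
nodes p =
  map spine (upTo (suc (spineLength p))) ++
  concatMap (λ k → map (λ d → hair k d) (map suc (upTo p))) (map suc (upTo (p ∸ 1)))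

Word : Set
Word = List ℕ

-- π(x,y): the word of edge labels along the unique simple path from x to y
-- in C_p.
π : ℕ → Node → Node → Word
π p (spine s)  (spine t)  = replicate ∣ s - t ∣ 0
π p (hair k d) (spine t)  = replicate d 1 ++ replicate ∣ pos p k - t ∣ 0
π p (spine t)  (hair k d) = replicate ∣ t - pos p k ∣ 0 ++ replicate d 1
π p (hair k d) (hair j e) =
  if k ≡ᵇ j
  then replicate ∣ d - e ∣ 1
  else replicate d 1 ++ replicate ∣ pos p k - pos p j ∣ 0 ++ replicate e 1

language : ℕ → List Word
language p = concatMap (λ x → map (π p x) (nodes p)) (nodes p)

IsPalindrome : Word → Set
IsPalindrome w = w ≡ reverse w

isPalindrome? : (w : Word) → Dec (IsPalindrome w)
isPalindrome? w = ≡-dec _≟_ w (reverse w)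

palCount : ℕ → ℕ
palCount p = length (deduplicate (≡-dec _≟_) (filter isPalindrome? (language p)))

-- Every path label of the comb has the form 1ᵈ 0ⁿ 1ᵉ with d, e ≤ p and n ≤ 3p², and for n > 0 such a
-- word is a palindrome only if d = e; this leaves O(p³) candidates.  Conversely, for 1 ≤ d ≤ p and
-- 1 ≤ j, t ≤ ⌊(p − 1)/2⌋, the path from depth d on the hair at the (j + t)-th distinguished node to
-- depth d on the hair at the j-th one reads 1ᵈ 0ⁿ 1ᵈ with n = a_{j+t} − a_j, and n determines (t, j):
-- if a_{j+t} + a_k = a_{k+u} + a_j, comparing multiples of 2p gives t = u and
-- (j + t)² + k² ≡ (k + t)² + j² (mod p), i.e. p ∣ 2t(k − j), so j = k.  This yields
-- p·⌊(p − 1)/2⌋² = Ω(p³) distinct palindromes.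
module Submission where

open import Defs
open import Data.Bool using (true; false; T)
open import Data.Empty using (⊥-elim)
open import Data.Fin using (Fin; zero; suc; toℕ; remQuot; combine)
open import Data.Fin.Properties using (injective⇒≤; toℕ-injective; toℕ<n; combine-remQuot)
open import Data.List using (List; []; _∷_; _++_; map; concatMap; length; lookup; replicate; reverse; _∷ʳ_; upTo; filter; deduplicate)
open import Data.List.Properties
  using (≡-dec; ++-assoc; ++-identityʳ; reverse-++; unfold-reverse; ∷-injectiveˡ; ∷-injectiveʳ; length-++; length-map; length-upTo)
open import Data.List.Membership.Propositional using (_∈_; lose; find)
open import Data.List.Membership.Propositional.Properties
  using (∈-lookup; ∈-++⁺ˡ; ∈-++⁺ʳ; ∈-++⁻; ∈-map⁺; ∈-map⁻; ∈-upTo⁺; ∈-upTo⁻; ∈-concatMap⁺; ∈-concatMap⁻;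
         ∈-filter⁺; ∈-filter⁻; ∈-deduplicate⁺; ∈-deduplicate⁻)
open import Data.List.Relation.Binary.Subset.Propositional using (_⊆_)
open import Data.List.Relation.Unary.Any using (index)
open import Data.List.Relation.Unary.Any.Properties using (lookup-index)
open import Data.List.Relation.Unary.All as All using ()
open import Data.List.Relation.Unary.AllPairs using (_∷_)
open import Data.List.Relation.Unary.Unique.Propositional using (Unique)
open import Data.List.Relation.Unary.Unique.DecPropositional.Properties using (deduplicate-!)
open import Data.Nat
open import Data.Nat.Properties
open import Data.Nat.DivMod using (_/_; m%n<n; m≡m%n+[m/n]*n; +-distrib-/-∣ʳ; m<n⇒m/n≡0; m*n/n≡m)
open import Data.Nat.Divisibility using (_∣_; _∤_; ∣m+n∣m⇒∣n; n∣m*n; >⇒∤)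
open import Data.Nat.Primality using (Prime; euclidsLemma)
open import Data.Nat.Tactic.RingSolver using (solve-∀)
open import Data.Product using (_×_; _,_; proj₁; proj₂; ∃-syntax; map₁; map₂; uncurry)
open import Data.Product.Properties using (×-≡,≡→≡; ×-≡,≡←≡)
open import Data.Sum using (inj₁; inj₂)
open import Function using (_∘_)
open import Function.Definitions using (Injective)
open import Relation.Binary.Definitions using (tri<; tri≈; tri>)
open import Relation.Binary.PropositionalEquality
open import Algebra.Properties.CommutativeSemigroup +-commutativeSemigroup using (xy∙z≈xz∙y)

module _ {A : Set} where

  injection⇒≤-length : ∀ {n} (ys : List A) (f : Fin n → A) →
                       Injective _≡_ _≡_ f → (∀ i → f i ∈ ys) → n ≤ length ys
  injection⇒≤-length ys f f-injective f∈ys = injective⇒≤ λ {i} {j} same-index →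
    f-injective (begin
      f i                              ≡⟨ lookup-index (f∈ys i) ⟩
      lookup ys (index (f∈ys i))       ≡⟨ cong (lookup ys) same-index ⟩
      lookup ys (index (f∈ys j))       ≡⟨ lookup-index (f∈ys j) ⟨
      f j                              ∎)
    where open ≡-Reasoning

  Unique⇒lookup-injective : ∀ {xs : List A} → Unique xs → Injective _≡_ _≡_ (lookup xs)
  Unique⇒lookup-injective (_  ∷ _) {zero}  {zero}  _  = refl
  Unique⇒lookup-injective (x∉ ∷ _) {zero}  {suc j} eq = ⊥-elim (All.lookup x∉ (∈-lookup j) eq)
  Unique⇒lookup-injective (x∉ ∷ _) {suc i} {zero}  eq = ⊥-elim (All.lookup x∉ (∈-lookup i) (sym eq))
  Unique⇒lookup-injective (_  ∷ u) {suc i} {suc j} eq = cong suc (Unique⇒lookup-injective u eq)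

  Unique∧⊆⇒length-≤ : ∀ {xs ys : List A} → Unique xs → xs ⊆ ys → length xs ≤ length ys
  Unique∧⊆⇒length-≤ {xs} {ys} xs-unique xs⊆ys =
    injection⇒≤-length ys (lookup xs) (Unique⇒lookup-injective xs-unique) (xs⊆ys ∘ ∈-lookup)

  length-concatMap-constant : ∀ {B : Set} (f : B → List A) m (xs : List B) →
                              (∀ x → length (f x) ≡ m) → length (concatMap f xs) ≡ length xs * m
  length-concatMap-constant f m []       _       = refl
  length-concatMap-constant f m (x ∷ xs) |f|≡m =
    trans (length-++ (f x)) (cong₂ _+_ (|f|≡m x) (length-concatMap-constant f m xs |f|≡m))

  length-map-upTo : ∀ (f : ℕ → A) n → length (map f (upTo n)) ≡ n
  length-map-upTo f n = trans (length-map f (upTo n)) (length-upTo n)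

  ∈-concatMap-intro : ∀ {B : Set} (f : B → List A) {xs x y} → x ∈ xs → y ∈ f x → y ∈ concatMap f xs
  ∈-concatMap-intro f x∈xs y∈fx = ∈-concatMap⁺ f (lose x∈xs y∈fx)

remQuot-injective : ∀ {m} n → Injective _≡_ _≡_ (remQuot {m} n)
remQuot-injective {m} n {i} {j} eq = begin
  i                                  ≡⟨ combine-remQuot {m} n i ⟨
  uncurry combine (remQuot {m} n i)  ≡⟨ cong (uncurry combine) eq ⟩
  uncurry combine (remQuot {m} n j)  ≡⟨ combine-remQuot {m} n j ⟩
  j                                  ∎
  where open ≡-Reasoning

box-injection⇒≤-length : ∀ {A : Set} {l m n} (ys : List A) (f : Fin l × Fin m × Fin n → A) →
                         Injective _≡_ _≡_ f → (∀ i → f i ∈ ys) → l * (m * n) ≤ length ys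
box-injection⇒≤-length {l = l} {m} {n} ys f f-injective f∈ys =
  injection⇒≤-length ys (f ∘ split) (split-injective ∘ f-injective) (f∈ys ∘ split)
  where
  split : Fin (l * (m * n)) → Fin l × Fin m × Fin n
  split = map₂ (remQuot n) ∘ remQuot (m * n)

  split-injective : Injective _≡_ _≡_ split
  split-injective eq with ×-≡,≡←≡ eq
  ... | same-fst , same-snd =
    remQuot-injective (m * n) (×-≡,≡→≡ (same-fst , remQuot-injective {m} n same-snd))

module _ {A : Set} where

  replicate-∷ʳ : ∀ n (x : A) → replicate n x ∷ʳ x ≡ x ∷ replicate n x
  replicate-∷ʳ zero    x = refl
  replicate-∷ʳ (suc n) x = cong (x ∷_) (replicate-∷ʳ n x)

  reverse-replicate : ∀ n (x : A) → reverse (replicate n x) ≡ replicate n x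
  reverse-replicate zero    x = refl
  reverse-replicate (suc n) x = begin
    reverse (x ∷ replicate n x)   ≡⟨ unfold-reverse x (replicate n x) ⟩
    reverse (replicate n x) ∷ʳ x  ≡⟨ cong (_∷ʳ x) (reverse-replicate n x) ⟩
    replicate n x ∷ʳ x            ≡⟨ replicate-∷ʳ n x ⟩
    x ∷ replicate n x             ∎
    where open ≡-Reasoning

  replicate-++ : ∀ m n (x : A) → replicate m x ++ replicate n x ≡ replicate (m + n) x
  replicate-++ zero    n x = refl
  replicate-++ (suc m) n x = cong (x ∷_) (replicate-++ m n x)

  replicate-++-cancel : ∀ {x y : A} {m n xs ys} → x ≢ y →
                        replicate m x ++ y ∷ xs ≡ replicate n x ++ y ∷ ys → m ≡ n × xs ≡ ys
  replicate-++-cancel {m = zero}  {zero}  x≢y eq = refl , ∷-injectiveʳ eq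
  replicate-++-cancel {m = zero}  {suc n} x≢y eq = ⊥-elim (x≢y (sym (∷-injectiveˡ eq)))
  replicate-++-cancel {m = suc m} {zero}  x≢y eq = ⊥-elim (x≢y (∷-injectiveˡ eq))
  replicate-++-cancel {m = suc m} {suc n} x≢y eq =
    map₁ (cong suc) (replicate-++-cancel x≢y (∷-injectiveʳ eq))

shape : ℕ → ℕ → ℕ → Word
shape d n e = replicate d 1 ++ replicate n 0 ++ replicate e 1

reverse-shape : ∀ d n e → reverse (shape d n e) ≡ shape e n d
reverse-shape d n e = begin
  reverse (replicate d 1 ++ replicate n 0 ++ replicate e 1)
    ≡⟨ reverse-++ (replicate d 1) (replicate n 0 ++ replicate e 1) ⟩
  reverse (replicate n 0 ++ replicate e 1) ++ reverse (replicate d 1)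
    ≡⟨ cong₂ _++_ (reverse-++ (replicate n 0) (replicate e 1)) (reverse-replicate d 1) ⟩
  (reverse (replicate e 1) ++ reverse (replicate n 0)) ++ replicate d 1
    ≡⟨ cong (_++ replicate d 1) (cong₂ _++_ (reverse-replicate e 1) (reverse-replicate n 0)) ⟩
  (replicate e 1 ++ replicate n 0) ++ replicate d 1
    ≡⟨ ++-assoc (replicate e 1) (replicate n 0) (replicate d 1) ⟩
  replicate e 1 ++ replicate n 0 ++ replicate d 1
    ∎
  where open ≡-Reasoning

shape-palindrome : ∀ d n → IsPalindrome (shape d n d)
shape-palindrome d n = sym (reverse-shape d n d)

palindrome-shape⇒balanced : ∀ d n e → IsPalindrome (shape d (suc n) e) → d ≡ e
palindrome-shape⇒balanced d n e pal =
  proj₁ (replicate-++-cancel {m = d} {e} (λ ()) (trans pal (reverse-shape d (suc n) e)))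

shape-injective : ∀ {d n d′ n′} → 0 < d → 0 < n → 0 < d′ → 0 < n′ →
                  shape d n d ≡ shape d′ n′ d′ → d ≡ d′ × n ≡ n′
shape-injective {suc d} {suc n} {suc d′} {suc n′} _ _ _ _ eq
  with refl , rest ← replicate-++-cancel {m = suc d} {suc d′} (λ ()) eq
  = refl , cong suc (proj₁ (replicate-++-cancel {m = n} {n′} (λ ()) rest))

∣[m∸o]-[n∸o]∣+n≡m : ∀ {m n o} → o ≤ n → n ≤ m → ∣ m ∸ o - n ∸ o ∣ + n ≡ m
∣[m∸o]-[n∸o]∣+n≡m {o = o} o≤n n≤m
  with u , refl ← m≤n⇒∃[o]m+o≡n o≤n | v , refl ← m≤n⇒∃[o]m+o≡n n≤m
  rewrite +-assoc o u v | m+n∸m≡n o (u + v) | m+n∸m≡n o u | ∣-∣-comm (u + v) u | ∣m-m+n∣≡n u v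
  = trans (+-comm v (o + u)) (+-assoc o u v)

m,n≤o⇒∣m-n∣≤o : ∀ {m n o} → m ≤ o → n ≤ o → ∣ m - n ∣ ≤ o
m,n≤o⇒∣m-n∣≤o {m} {n} m≤o n≤o = ≤-trans (∣m-n∣≤m⊔n m n) (⊔-lub m≤o n≤o)

quotient-unique : ∀ {n r r′ t t′} .{{_ : NonZero n}} → r < n → r′ < n →
                  r + t * n ≡ r′ + t′ * n → t ≡ t′ × r ≡ r′
quotient-unique {n} {r} {r′} {t} {t′} r<n r′<n eq =
  t≡t′ , +-cancelʳ-≡ (t′ * n) r r′ (subst (λ x → r + x * n ≡ r′ + t′ * n) t≡t′ eq)
  where
  [r+t*n]/n≡t : ∀ {r t} → r < n → (r + t * n) / n ≡ t
  [r+t*n]/n≡t {r} {t} r<n = trans (+-distrib-/-∣ʳ r (n∣m*n t)) (cong₂ _+_ (m<n⇒m/n≡0 r<n) (m*n/n≡m t n))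

  t≡t′ : t ≡ t′
  t≡t′ = trans (sym ([r+t*n]/n≡t r<n)) (trans (cong (_/ n) eq) ([r+t*n]/n≡t r′<n))

spineBound : ℕ → ℕ
spineBound p = 3 * p * p

sqmod<p : ∀ p .{{_ : NonZero p}} k → sqmod p k < p
sqmod<p (suc q) k = m%n<n (k * k) (suc q)

k*k≡sqmod+[k*k/p]*p : ∀ p .{{_ : NonZero p}} k → k * k ≡ sqmod p k + (k * k / p) * p
k*k≡sqmod+[k*k/p]*p (suc q) k = m≡m%n+[m/n]*n (k * k) (suc q)

module _ (p : ℕ) .{{_ : NonZero p}} where

  a-monoʳ-< : ∀ {j k} → j < k → a p j < a p k
  a-monoʳ-< {j} {k} j<k = begin-strict
    2 * p * j + sqmod p j  <⟨ +-monoʳ-< (2 * p * j) (sqmod<p p j) ⟩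
    2 * p * j + p          ≤⟨ +-monoʳ-≤ (2 * p * j) (m≤m+n p (p + 0)) ⟩
    2 * p * j + 2 * p      ≡⟨ +-comm (2 * p * j) (2 * p) ⟩
    2 * p + 2 * p * j      ≡⟨ *-suc (2 * p) j ⟨
    2 * p * suc j          ≤⟨ *-monoʳ-≤ (2 * p) j<k ⟩
    2 * p * k              ≤⟨ m≤m+n (2 * p * k) (sqmod p k) ⟩
    2 * p * k + sqmod p k  ∎
    where open ≤-Reasoning

  a-monoʳ-≤ : ∀ {j k} → j ≤ k → a p j ≤ a p k
  a-monoʳ-≤ j≤k with m≤n⇒m<n∨m≡n j≤k
  ... | inj₁ j<k  = <⇒≤ (a-monoʳ-< j<k)
  ... | inj₂ refl = ≤-refl

  a≤spineBound : ∀ {k} → k ≤ p → a p k ≤ spineBound p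
  a≤spineBound {k} k≤p = begin
    2 * p * k + sqmod p k  ≤⟨ +-mono-≤ (*-monoʳ-≤ (2 * p) k≤p) (<⇒≤ (sqmod<p p k)) ⟩
    2 * p * p + p          ≤⟨ +-monoʳ-≤ (2 * p * p) (m≤m*n p p) ⟩
    2 * p * p + p * p      ≡⟨ 2pp+pp≡3pp p ⟩
    3 * p * p              ∎
    where
    open ≤-Reasoning
    2pp+pp≡3pp : ∀ p → 2 * p * p + p * p ≡ 3 * p * p
    2pp+pp≡3pp = solve-∀

  pos≤spineBound : ∀ {k} → k ≤ p → pos p k ≤ spineBound p
  pos≤spineBound {k} k≤p = ≤-trans (m∸n≤m (a p k) (a p 1)) (a≤spineBound k≤p)

  ∣pos-pos∣+a≡a : ∀ {j k} → 0 < j → j ≤ k → ∣ pos p k - pos p j ∣ + a p j ≡ a p k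
  ∣pos-pos∣+a≡a 0<j j≤k = ∣[m∸o]-[n∸o]∣+n≡m (a-monoʳ-≤ 0<j) (a-monoʳ-≤ j≤k)

  ∣pos-pos∣>0 : ∀ {j k} → 0 < j → j < k → 0 < ∣ pos p k - pos p j ∣
  ∣pos-pos∣>0 {j} 0<j j<k = n≢0⇒n>0 λ gap≡0 →
    <⇒≢ (a-monoʳ-< j<k) (trans (cong (_+ a p j) (sym gap≡0)) (∣pos-pos∣+a≡a 0<j (<⇒≤ j<k)))

  sqmod-sums≡⇒∣ : ∀ {x y u v c} → x * x + y * y ≡ (u * u + v * v) + c →
                 sqmod p x + sqmod p y ≡ sqmod p u + sqmod p v → p ∣ c
  sqmod-sums≡⇒∣ {x} {y} {u} {v} {c} squares residues =
    ∣m+n∣m⇒∣n (subst (p ∣_) quotients (n∣m*n (Q x + Q y))) (n∣m*n (Q u + Q v))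
    where
    Q : ℕ → ℕ
    Q z = z * z / p

    regroup : ∀ s s′ q q′ p → (s + q * p) + (s′ + q′ * p) ≡ (s + s′) + (q + q′) * p
    regroup = solve-∀

    split : ∀ z w → z * z + w * w ≡ (sqmod p z + sqmod p w) + (Q z + Q w) * p
    split z w = trans (cong₂ _+_ (k*k≡sqmod+[k*k/p]*p p z) (k*k≡sqmod+[k*k/p]*p p w)) (regroup (sqmod p z) (sqmod p w) (Q z) (Q w) p)

    quotients : (Q x + Q y) * p ≡ (Q u + Q v) * p + c
    quotients = +-cancelˡ-≡ (sqmod p u + sqmod p v) _ _ (begin
      (sqmod p u + sqmod p v) + (Q x + Q y) * p        ≡⟨ cong (_+ (Q x + Q y) * p) residues ⟨
      (sqmod p x + sqmod p y) + (Q x + Q y) * p        ≡⟨ split x y ⟨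
      x * x + y * y                                    ≡⟨ squares ⟩
      (u * u + v * v) + c                              ≡⟨ cong (_+ c) (split u v) ⟩
      ((sqmod p u + sqmod p v) + (Q u + Q v) * p) + c  ≡⟨ +-assoc (sqmod p u + sqmod p v) ((Q u + Q v) * p) c ⟩
      (sqmod p u + sqmod p v) + ((Q u + Q v) * p + c)  ∎)
      where open ≡-Reasoning

  prime∤2*m*n : Prime p → 2 < p → ∀ {m n} → 0 < m → m < p → 0 < n → n < p → p ∤ 2 * m * n
  prime∤2*m*n p-prime 2<p {m} {n} 0<m m<p 0<n n<p p∣2mn with euclidsLemma (2 * m) n p-prime p∣2mn
  ... | inj₂ p∣n = >⇒∤ {{>-nonZero 0<n}} n<p p∣n
  ... | inj₁ p∣2m with euclidsLemma 2 m p-prime p∣2m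
  ...   | inj₁ p∣2 = >⇒∤ 2<p p∣2
  ...   | inj₂ p∣m = >⇒∤ {{>-nonZero 0<m}} m<p p∣m

  sqmod-shift-≢ : Prime p → 2 < p → ∀ {j k t} → j < k → k < p → 0 < t → t < p →
                  sqmod p (j + t) + sqmod p k ≢ sqmod p (k + t) + sqmod p j
  sqmod-shift-≢ p-prime 2<p {j} {k} {t} j<k k<p 0<t t<p residues
    with e , refl ← m≤n⇒∃[o]m+o≡n (<⇒≤ j<k)
    = prime∤2*m*n p-prime 2<p 0<e (≤-<-trans (m≤n+m e j) k<p) 0<t t<p
        (sqmod-sums≡⇒∣ (squares j e t) (sym residues))
    where
    0<e : 0 < e
    0<e = +-cancelˡ-< j 0 e (subst (_< j + e) (sym (+-identityʳ j)) j<k)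

    squares : ∀ j e t → (j + e + t) * (j + e + t) + j * j ≡ ((j + t) * (j + t) + (j + e) * (j + e)) + 2 * e * t
    squares = solve-∀

  sqmod-+-injective : Prime p → 2 < p → ∀ {j k t} → j < p → k < p → 0 < t → t < p →
                      sqmod p (j + t) + sqmod p k ≡ sqmod p (k + t) + sqmod p j → j ≡ k
  sqmod-+-injective p-prime 2<p {j} {k} j<p k<p 0<t t<p residues with <-cmp j k
  ... | tri≈ _ j≡k _ = j≡k
  ... | tri< j<k _ _ = ⊥-elim (sqmod-shift-≢ p-prime 2<p j<k k<p 0<t t<p residues)
  ... | tri> _ _ k<j = ⊥-elim (sqmod-shift-≢ p-prime 2<p k<j j<p 0<t t<p (sym residues))

  sqmod-+<2*p : ∀ x y → sqmod p x + sqmod p y < 2 * p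
  sqmod-+<2*p x y =
    <-≤-trans (+-mono-< (sqmod<p p x) (sqmod<p p y)) (≤-reflexive (cong (p +_) (sym (+-identityʳ p))))

  ∣pos-pos∣≡⇒a+a≡a+a : ∀ {j k t u} → 0 < j → 0 < k →
                       ∣ pos p (j + t) - pos p j ∣ ≡ ∣ pos p (k + u) - pos p k ∣ →
                       a p (j + t) + a p k ≡ a p (k + u) + a p j
  ∣pos-pos∣≡⇒a+a≡a+a {j} {k} {t} {u} 0<j 0<k gaps = begin
    a p (j + t) + a p k                            ≡⟨ cong (_+ a p k) (∣pos-pos∣+a≡a 0<j (m≤m+n j t)) ⟨
    ∣ pos p (j + t) - pos p j ∣ + a p j + a p k    ≡⟨ cong (λ g → g + a p j + a p k) gaps ⟩
    ∣ pos p (k + u) - pos p k ∣ + a p j + a p k    ≡⟨ xy∙z≈xz∙y ∣ pos p (k + u) - pos p k ∣ (a p j) (a p k) ⟩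
    ∣ pos p (k + u) - pos p k ∣ + a p k + a p j    ≡⟨ cong (_+ a p j) (∣pos-pos∣+a≡a 0<k (m≤m+n k u)) ⟩
    a p (k + u) + a p j                            ∎
    where open ≡-Reasoning

  -- a p k = 2p·k + (k² mod p), so a sum of two a-values is a multiple of 2p plus a remainder below 2p.
  a+a≡a+a⇒t≡u×residues≡ : ∀ {j k t u} → a p (j + t) + a p k ≡ a p (k + u) + a p j →
             t ≡ u × sqmod p (j + t) + sqmod p k ≡ sqmod p (k + u) + sqmod p j
  a+a≡a+a⇒t≡u×residues≡ {j} {k} {t} {u} sums =
    quotient-unique {{m*n≢0 2 p}} (sqmod-+<2*p (j + t) k) (sqmod-+<2*p (k + u) j) (+-cancelˡ-≡ (2 * p * (j + k)) _ _ (begin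
      2 * p * (j + k) + ((sqmod p (j + t) + sqmod p k) + t * (2 * p))  ≡⟨ a-+-a j t k ⟨
      a p (j + t) + a p k                                              ≡⟨ sums ⟩
      a p (k + u) + a p j                                              ≡⟨ a-+-a k u j ⟩
      2 * p * (k + j) + ((sqmod p (k + u) + sqmod p j) + u * (2 * p))  ≡⟨ cong (λ s → 2 * p * s + ((sqmod p (k + u) + sqmod p j) + u * (2 * p))) (+-comm k j) ⟩
      2 * p * (j + k) + ((sqmod p (k + u) + sqmod p j) + u * (2 * p))  ∎))
    where
    open ≡-Reasoning

    rearrange : ∀ P j t k s s′ → P * (j + t) + s + (P * k + s′) ≡ P * (j + k) + ((s + s′) + t * P)
    rearrange = solve-∀

    a-+-a : ∀ j t k → a p (j + t) + a p k ≡ 2 * p * (j + k) + ((sqmod p (j + t) + sqmod p k) + t * (2 * p))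
    a-+-a j t k = rearrange (2 * p) j t k (sqmod p (j + t)) (sqmod p k)

  ∣pos-pos∣-injective : Prime p → 2 < p → ∀ {j k t u} → 0 < j → 0 < k → j < p → k < p → 0 < t → t < p →
                        ∣ pos p (j + t) - pos p j ∣ ≡ ∣ pos p (k + u) - pos p k ∣ → t ≡ u × j ≡ k
  ∣pos-pos∣-injective p-prime 2<p 0<j 0<k j<p k<p 0<t t<p gaps
    with refl , residues ← a+a≡a+a⇒t≡u×residues≡ (∣pos-pos∣≡⇒a+a≡a+a 0<j 0<k gaps)
    = refl , sqmod-+-injective p-prime 2<p j<p k<p 0<t t<p residues

Pal : ℕ → List Word
Pal p = deduplicate (≡-dec _≟_) (filter isPalindrome? (language p))

Pal-unique : ∀ p → Unique (Pal p)
Pal-unique p = deduplicate-! (≡-dec _≟_) (filter isPalindrome? (language p))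

module _ (p : ℕ) where

  ∈-language⁺ : ∀ {x y} → x ∈ nodes p → y ∈ nodes p → π p x y ∈ language p
  ∈-language⁺ {x} x∈nodes y∈nodes =
    ∈-concatMap-intro (λ x → map (π p x) (nodes p)) x∈nodes (∈-map⁺ (π p x) y∈nodes)

  ∈-language⁻ : ∀ {w} → w ∈ language p → ∃[ x ] ∃[ y ] x ∈ nodes p × y ∈ nodes p × w ≡ π p x y
  ∈-language⁻ w∈language
    with x , x∈nodes , w∈row ← find (∈-concatMap⁻ (λ x → map (π p x) (nodes p)) w∈language)
    with y , y∈nodes , refl ← ∈-map⁻ (π p x) w∈row
    = x , y , x∈nodes , y∈nodes , refl

  ∈-Pal⁺ : ∀ {w} → w ∈ language p → IsPalindrome w → w ∈ Pal p
  ∈-Pal⁺ w∈language w-pal = ∈-deduplicate⁺ (≡-dec _≟_) (∈-filter⁺ isPalindrome? w∈language w-pal)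

  ∈-Pal⁻ : ∀ {w} → w ∈ Pal p → w ∈ language p × IsPalindrome w
  ∈-Pal⁻ w∈Pal = ∈-filter⁻ isPalindrome? (∈-deduplicate⁻ (≡-dec _≟_) (filter isPalindrome? (language p)) w∈Pal)


hair∈nodes : ∀ {p k d} → 0 < k → k < p → 0 < d → d ≤ p → hair k d ∈ nodes p
hair∈nodes {suc q} {suc k} {suc d} _ (s≤s k<q) _ d≤p =
  ∈-++⁺ʳ (map spine (upTo (suc (spineLength (suc q)))))
    (∈-concatMap-intro _ (∈-map⁺ suc (∈-upTo⁺ k<q)) (∈-map⁺ (hair (suc k)) (∈-map⁺ suc (∈-upTo⁺ d≤p))))

module _ (p : ℕ) .{{_ : NonZero p}} where

  private
    hairs : ℕ → List Node
    hairs k = map (hair k) (map suc (upTo p))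

    stalks : List ℕ
    stalks = map suc (upTo (p ∸ 1))

  spine∈nodes⇒≤spineBound : ∀ {s} → spine s ∈ nodes p → s ≤ spineBound p
  spine∈nodes⇒≤spineBound s∈nodes with ∈-++⁻ (map spine (upTo (suc (spineLength p)))) s∈nodes
  ... | inj₁ s∈spine with _ , s<L+1 , refl ← ∈-map⁻ spine s∈spine =
    ≤-trans (≤-pred (∈-upTo⁻ s<L+1)) (pos≤spineBound p (m∸n≤m p 1))
  ... | inj₂ s∈hairs with _ , _ , s∈hair ← find (∈-concatMap⁻ hairs {stalks} s∈hairs)
    with _ , _ , () ← ∈-map⁻ (hair _) s∈hair

  hair∈nodes⇒bounded : ∀ {k d} → hair k d ∈ nodes p → d ≤ p × pos p k ≤ spineBound p
  hair∈nodes⇒bounded h∈nodes with ∈-++⁻ (map spine (upTo (suc (spineLength p)))) h∈nodes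
  ... | inj₁ h∈spine with _ , _ , () ← ∈-map⁻ spine h∈spine
  ... | inj₂ h∈hairs with k , k∈stalks , h∈hair ← find (∈-concatMap⁻ hairs {stalks} h∈hairs)
    with _ , d∈depths , refl ← ∈-map⁻ (hair k) h∈hair
    with k′ , k′<p-1 , refl ← ∈-map⁻ suc k∈stalks
    with d′ , d′<p , refl ← ∈-map⁻ suc d∈depths
    = ∈-upTo⁻ d′<p , pos≤spineBound p (≤-trans (∈-upTo⁻ k′<p-1) (m∸n≤m p 1))

balancedShapes : ℕ → ℕ → List Word
balancedShapes p d = map (λ n → shape d n d) (upTo (suc (spineBound p)))

candidates : ℕ → List Word
candidates p = map (λ n → replicate n 1) (upTo (suc (2 * p))) ++ concatMap (balancedShapes p) (upTo (suc p))

length-candidates : ∀ p → length (candidates p) ≡ suc (2 * p) + suc p * suc (spineBound p)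
length-candidates p = trans (length-++ (map (λ n → replicate n 1) (upTo (suc (2 * p)))))
  (cong₂ _+_ (length-map-upTo (λ n → replicate n 1) (suc (2 * p)))
             (trans (length-concatMap-constant (balancedShapes p) _ (upTo (suc p))
                       (λ d → length-map-upTo (λ n → shape d n d) (suc (spineBound p))))
                    (cong (_* suc (spineBound p)) (length-upTo (suc p)))))

palindromic-shape∈candidates : ∀ {p d n e} → d ≤ p → n ≤ spineBound p → e ≤ p →
                               IsPalindrome (shape d n e) → shape d n e ∈ candidates p
palindromic-shape∈candidates {p} {d} {zero} {e} d≤p _ e≤p _ =
  subst (_∈ candidates p) (sym (replicate-++ d e 1))
    (∈-++⁺ˡ (∈-map⁺ (λ n → replicate n 1) (∈-upTo⁺ (s≤s (+-mono-≤ d≤p (≤-trans e≤p (m≤m+n p 0)))))))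
palindromic-shape∈candidates {p} {d} {suc n} {e} d≤p n≤B _ pal with refl ← palindrome-shape⇒balanced d n e pal =
  ∈-++⁺ʳ (map (λ n → replicate n 1) (upTo (suc (2 * p))))
    (∈-concatMap-intro (balancedShapes p) (∈-upTo⁺ (s≤s d≤p)) (∈-map⁺ (λ n → shape d n d) (∈-upTo⁺ (s≤s n≤B))))

module _ (p : ℕ) .{{_ : NonZero p}} where

  private
    by-shape : ∀ {w d n e} → w ≡ shape d n e → d ≤ p → n ≤ spineBound p → e ≤ p →
               IsPalindrome w → w ∈ candidates p
    by-shape refl = palindromic-shape∈candidates

  π∈candidates : ∀ {x y} → x ∈ nodes p → y ∈ nodes p → IsPalindrome (π p x y) → π p x y ∈ candidates p
  π∈candidates {spine s} {spine t} s∈ t∈ =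
    by-shape (sym (++-identityʳ _)) z≤n (m,n≤o⇒∣m-n∣≤o (spine∈nodes⇒≤spineBound p s∈) (spine∈nodes⇒≤spineBound p t∈)) z≤n
  π∈candidates {hair k d} {spine t} h∈ t∈ with d≤p , k≤B ← hair∈nodes⇒bounded p h∈ =
    by-shape (cong (replicate d 1 ++_) (sym (++-identityʳ _))) d≤p (m,n≤o⇒∣m-n∣≤o k≤B (spine∈nodes⇒≤spineBound p t∈)) z≤n
  π∈candidates {spine t} {hair k d} t∈ h∈ with d≤p , k≤B ← hair∈nodes⇒bounded p h∈ =
    by-shape refl z≤n (m,n≤o⇒∣m-n∣≤o (spine∈nodes⇒≤spineBound p t∈) k≤B) d≤p
  π∈candidates {hair k d} {hair j e} h∈ h′∈
    with d≤p , k≤B ← hair∈nodes⇒bounded p h∈ | e≤p , j≤B ← hair∈nodes⇒bounded p h′∈ | k ≡ᵇ j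
  ... | true  = by-shape (sym (++-identityʳ _)) (m,n≤o⇒∣m-n∣≤o d≤p e≤p) z≤n z≤n
  ... | false = by-shape refl d≤p (m,n≤o⇒∣m-n∣≤o k≤B j≤B) e≤p

Pal⊆candidates : ∀ p .{{_ : NonZero p}} → Pal p ⊆ candidates p
Pal⊆candidates p w∈Pal
  with w∈language , w-pal ← ∈-Pal⁻ p w∈Pal
  with _ , _ , x∈nodes , y∈nodes , refl ← ∈-language⁻ p w∈language
  = π∈candidates p x∈nodes y∈nodes w-pal

palCount≤12p³ : ∀ p .{{_ : NonZero p}} → palCount p ≤ 12 * p ^ 3
palCount≤12p³ p@(suc q) = begin
  palCount p                                            ≤⟨ Unique∧⊆⇒length-≤ (Pal-unique p) (Pal⊆candidates p) ⟩
  length (candidates p)                                 ≡⟨ length-candidates p ⟩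
  suc (2 * p) + suc p * suc (spineBound p)              ≤⟨ m≤m+n _ (9 * q * q * q + 24 * q * q + 18 * q + 1) ⟩
  suc (2 * p) + suc p * suc (spineBound p) + (9 * q * q * q + 24 * q * q + 18 * q + 1)
                                                        ≡⟨ cubic q ⟩
  12 * p ^ 3                                            ∎
  where
  open ≤-Reasoning
  cubic : ∀ q → suc (2 * suc q) + suc (suc q) * suc (3 * suc q * suc q) + (9 * q * q * q + 24 * q * q + 18 * q + 1)
                ≡ 12 * (suc q * (suc q * (suc q * 1)))
  cubic = solve-∀

π-distinct-hairs : ∀ p {k j d e} → k ≢ j → π p (hair k d) (hair j e) ≡ shape d ∣ pos p k - pos p j ∣ e
π-distinct-hairs p {k} {j} k≢j with k ≡ᵇ j in k≡ᵇj
... | true  = ⊥-elim (k≢j (≡ᵇ⇒≡ k j (subst T (sym k≡ᵇj) _)))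
... | false = refl

n≤1+⌊n/2⌋+⌊n/2⌋ : ∀ n → n ≤ suc (⌊ n /2⌋ + ⌊ n /2⌋)
n≤1+⌊n/2⌋+⌊n/2⌋ zero          = z≤n
n≤1+⌊n/2⌋+⌊n/2⌋ (suc zero)    = s≤s z≤n
n≤1+⌊n/2⌋+⌊n/2⌋ (suc (suc n)) =
  s≤s (subst (suc n ≤_) (sym (cong suc (+-suc ⌊ n /2⌋ ⌊ n /2⌋))) (s≤s (n≤1+⌊n/2⌋+⌊n/2⌋ n)))

module _ (q : ℕ) (p-prime : Prime (suc q)) (2<p : 2 < suc q) where

  private
    p h : ℕ
    p = suc q
    h = ⌊ q /2⌋

    toℕ⁺ : ∀ {n} → Fin n → ℕ
    toℕ⁺ i = suc (toℕ i)

    toℕ⁺-injective : ∀ {n} {i j : Fin n} → toℕ⁺ i ≡ toℕ⁺ j → i ≡ j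
    toℕ⁺-injective = toℕ-injective ∘ suc-injective

    j+t<p : ∀ {j t} → j ≤ h → t ≤ h → j + t < p
    j+t<p j≤h t≤h = s≤s (≤-trans (+-mono-≤ j≤h t≤h) (≤-trans (+-monoʳ-≤ h (⌊n/2⌋≤⌈n/2⌉ q)) (≤-reflexive (⌊n/2⌋+⌈n/2⌉≡n q))))

    gap>0 : ∀ (t j : Fin h) → 0 < ∣ pos p (toℕ⁺ j + toℕ⁺ t) - pos p (toℕ⁺ j) ∣
    gap>0 t j = ∣pos-pos∣>0 p z<s (m<m+n (toℕ⁺ j) z<s)

    j<p : ∀ (t j : Fin h) → toℕ⁺ j < p
    j<p t j = ≤-<-trans (m≤m+n (toℕ⁺ j) (toℕ⁺ t)) (j+t<p (toℕ<n j) (toℕ<n t))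

    t<p : ∀ (t j : Fin h) → toℕ⁺ t < p
    t<p t j = ≤-<-trans (m≤n+m (toℕ⁺ t) (toℕ⁺ j)) (j+t<p (toℕ<n j) (toℕ<n t))

  -- The label of the path from hair (j + t) to hair j, both at depth d.
  rung : Fin p × Fin h × Fin h → Word
  rung (d , t , j) = shape (toℕ⁺ d) ∣ pos p (toℕ⁺ j + toℕ⁺ t) - pos p (toℕ⁺ j) ∣ (toℕ⁺ d)

  rung∈Pal : ∀ x → rung x ∈ Pal p
  rung∈Pal (d , t , j) =
    ∈-Pal⁺ p (subst (_∈ language p) (π-distinct-hairs p {d = toℕ⁺ d} {e = toℕ⁺ d} (>⇒≢ (m<m+n (toℕ⁺ j) z<s))) path∈language)
      (shape-palindrome (toℕ⁺ d) ∣ pos p (toℕ⁺ j + toℕ⁺ t) - pos p (toℕ⁺ j) ∣)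
    where
    path∈language : π p (hair (toℕ⁺ j + toℕ⁺ t) (toℕ⁺ d)) (hair (toℕ⁺ j) (toℕ⁺ d)) ∈ language p
    path∈language = ∈-language⁺ p
      (hair∈nodes {p} z<s (j+t<p (toℕ<n j) (toℕ<n t)) z<s (toℕ<n d))
      (hair∈nodes {p} z<s (j<p t j) z<s (toℕ<n d))

  rung-injective : Injective _≡_ _≡_ rung
  rung-injective {d , t , j} {d′ , t′ , j′} same-rung =
    ×-≡,≡→≡ (toℕ⁺-injective (proj₁ depths&gaps) ,
             ×-≡,≡→≡ (toℕ⁺-injective (proj₁ steps&stalks) , toℕ⁺-injective (proj₂ steps&stalks)))
    where
    depths&gaps : toℕ⁺ d ≡ toℕ⁺ d′ ×
                  ∣ pos p (toℕ⁺ j + toℕ⁺ t) - pos p (toℕ⁺ j) ∣ ≡ ∣ pos p (toℕ⁺ j′ + toℕ⁺ t′) - pos p (toℕ⁺ j′) ∣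
    depths&gaps = shape-injective z<s (gap>0 t j) z<s (gap>0 t′ j′) same-rung

    steps&stalks : toℕ⁺ t ≡ toℕ⁺ t′ × toℕ⁺ j ≡ toℕ⁺ j′
    steps&stalks =
      ∣pos-pos∣-injective p p-prime 2<p z<s z<s (j<p t j) (j<p t′ j′) z<s (t<p t j) (proj₂ depths&gaps)

  p*h²≤palCount : p * (h * h) ≤ palCount p
  p*h²≤palCount = box-injection⇒≤-length (Pal p) rung rung-injective rung∈Pal

  p³≤16*palCount : p ^ 3 ≤ 16 * palCount p
  p³≤16*palCount = begin
    p ^ 3                  ≡⟨ cong (λ x → p * (p * x)) (*-identityʳ p) ⟩
    p * (p * p)            ≤⟨ *-monoʳ-≤ p (*-mono-≤ p≤4h p≤4h) ⟩
    p * (4 * h * (4 * h))  ≡⟨ regroup p h ⟩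
    16 * (p * (h * h))     ≤⟨ *-monoʳ-≤ 16 p*h²≤palCount ⟩
    16 * palCount p        ∎
    where
    open ≤-Reasoning

    regroup : ∀ p h → p * (4 * h * (4 * h)) ≡ 16 * (p * (h * h))
    regroup = solve-∀

    double : ∀ h → h + h + (h + h) ≡ 4 * h
    double = solve-∀

    p≤4h : p ≤ 4 * h
    p≤4h = begin
      suc q            ≤⟨ s≤s (n≤1+⌊n/2⌋+⌊n/2⌋ q) ⟩
      2 + (h + h)      ≤⟨ +-monoˡ-≤ (h + h) (+-mono-≤ 1≤h 1≤h) ⟩
      h + h + (h + h)  ≡⟨ double h ⟩
      4 * h            ∎
      where
      1≤h : 1 ≤ h
      1≤h = ⌊n/2⌋-mono (≤-pred 2<p)

lemma1 : ∃[ c ] ∃[ C ] ∃[ N ]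
           ((p : ℕ) → Prime p → N ≤ p →
             (p ^ 3 ≤ c * palCount p) × (palCount p ≤ C * p ^ 3))
lemma1 = 16 , 12 , 3 , bounds
  where
  bounds : (p : ℕ) → Prime p → 3 ≤ p → (p ^ 3 ≤ 16 * palCount p) × (palCount p ≤ 12 * p ^ 3)
  bounds (suc q) p-prime 3≤p = p³≤16*palCount q p-prime 3≤p , palCount≤12p³ (suc q)
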